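{- Let $\mathfrak A$ be a J-algebra or a relation algebra and let $a,b\in A$ satisfy $a^{\smile};a\le1'$, $b^{\smile};b\le1'$ and $1=a^{\smile};b$. Then for all $u,v,x,y\in A$, $$u;v\cdot x;y=(u;a^{\smile}\cdot x;b^{\smile});(a;v\cdot b;y).$$
   Context: A J-algebra is an algebra $\langle A,\cdot,0,1,;,{}^{\smile},1'\rangle$ satisfying for all $x,y,z$: $x\cdot(y\cdot z)=(x\cdot y)\cdot z$, $x\cdot y=y\cdot x$, $x\cdot x=x$, $x;(y;z)=(x;y);z$, $x;1'=x$, $(x\cdot y);z=(x\cdot y);z\cdot y;z$, $x^{\smile\smile}=x$, $(x;y)^{\smile}=y^{\smile};x^{\smile}$, $(x\cdot y)^{\smile}=x^{\smile}\cdot y^{\smile}$, $x;y\cdot z=(z;y^{\smile}\cdot x);(y\cdot x^{\smile};z)\cdot z$, $0\cdot x=0$, $x\cdot1=x$, $x;0=0$. A relation algebra (Tarski) $\langle A,+,\cdot,-,0,1,;,{}^{\smile},1'\rangle$ satisfies: $+$ commutative and associative, $-(-x+-y)+-(-x+y)=x$, $;$ associative, $(x+y);z=x;z+y;z$, $x;1'=x$, $x^{\smile\smile}=x$, $(x+y)^{\smile}=x^{\smile}+y^{\smile}$, $(x;y)^{\smile}=y^{\smile};x^{\smile}$, $x^{\smile};-(x;y)+-y=-y$, $x\cdot y=-(-x+-y)$, $1=1'+-1'$, $0=-1$. Converse binds tightest, then $;$, then $\cdot$. $x\le y$ means $x\cdot y=x$. -}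

module Defs where

open import Level using (Level; suc)
open import Relation.Binary.PropositionalEquality using (_≡_)

record JAlgebra (ℓ : Level) : Set (suc ℓ) where
  infixl 6 _·_
  infixl 7 _⨾_
  infix 9 _˘
  infix 4 _≤_
  field
    Carrier : Set ℓ
    _·_ : Carrier → Carrier → Carrier
    𝟘 𝟙 : Carrier
    _⨾_ : Carrier → Carrier → Carrier
    _˘ : Carrier → Carrier
    1' : Carrier
    ·-assoc : ∀ x y z → x · (y · z) ≡ (x · y) · z
    ·-comm : ∀ x y → x · y ≡ y · x
    ·-idem : ∀ x → x · x ≡ x
    ⨾-assoc : ∀ x y z → x ⨾ (y ⨾ z) ≡ (x ⨾ y) ⨾ z
    ⨾-1' : ∀ x → x ⨾ 1' ≡ x
    ·⨾-mono : ∀ x y z → (x · y) ⨾ z ≡ (x · y) ⨾ z · y ⨾ z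
    ˘˘ : ∀ x → x ˘ ˘ ≡ x
    ⨾-˘ : ∀ x y → (x ⨾ y) ˘ ≡ y ˘ ⨾ x ˘
    ·-˘ : ∀ x y → (x · y) ˘ ≡ x ˘ · y ˘
    modular : ∀ x y z → x ⨾ y · z ≡ (z ⨾ y ˘ · x) ⨾ (y · x ˘ ⨾ z) · z
    𝟘-· : ∀ x → 𝟘 · x ≡ 𝟘
    ·-𝟙 : ∀ x → x · 𝟙 ≡ x
    ⨾-𝟘 : ∀ x → x ⨾ 𝟘 ≡ 𝟘

  _≤_ : Carrier → Carrier → Set ℓ
  x ≤ y = x · y ≡ x

record RelationAlgebra (ℓ : Level) : Set (suc ℓ) where
  infixl 5 _+_
  infixl 6 _·_
  infixl 7 _⨾_
  infix 8 -_
  infix 9 _˘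
  infix 4 _≤_
  field
    Carrier : Set ℓ
    _+_ _·_ : Carrier → Carrier → Carrier
    -_ : Carrier → Carrier
    𝟘 𝟙 : Carrier
    _⨾_ : Carrier → Carrier → Carrier
    _˘ : Carrier → Carrier
    1' : Carrier
    +-comm : ∀ x y → x + y ≡ y + x
    +-assoc : ∀ x y z → x + (y + z) ≡ (x + y) + z
    huntington : ∀ x y → - (- x + - y) + - (- x + y) ≡ x
    ⨾-assoc : ∀ x y z → x ⨾ (y ⨾ z) ≡ (x ⨾ y) ⨾ z
    ⨾-distribʳ-+ : ∀ x y z → (x + y) ⨾ z ≡ x ⨾ z + y ⨾ z
    ⨾-1' : ∀ x → x ⨾ 1' ≡ x
    ˘˘ : ∀ x → x ˘ ˘ ≡ x
    +-˘ : ∀ x y → (x + y) ˘ ≡ x ˘ + y ˘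
    ⨾-˘ : ∀ x y → (x ⨾ y) ˘ ≡ y ˘ ⨾ x ˘
    tarski : ∀ x y → x ˘ ⨾ - (x ⨾ y) + - y ≡ - y
    ·-def : ∀ x y → x · y ≡ - (- x + - y)
    𝟙-def : 𝟙 ≡ 1' + - 1'
    𝟘-def : 𝟘 ≡ - 𝟙

  _≤_ : Carrier → Carrier → Set ℓ
  x ≤ y = x · y ≡ x

-- Read a and b as the two projections of a pairing: as a and b are functional and
-- a˘ ⨾ b = 𝟙, every pair of points (r, s) has a code m with m a r and m b s. The right-hand
-- side witnesses u ⨾ v · x ⨾ y by sending both paths through the code of their two
-- midpoints. Equationally, the modular law first factors u ⨾ v · z through a, giving a
-- code whose b-coordinate is still wrong; a second use of it re-pairs the code, and
-- functionality of a and b cancels the detours a˘ ⨾ a and b˘ ⨾ b. Relation algebras are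
-- J-algebras: by Huntington's theorem their Boolean part is a Boolean algebra, and the
-- modular law follows from Tarski's axiom through the Schröder equivalences.

module Submission where

open import Level using (Level) renaming (suc to lsuc)
open import Function using (_∘_)
open import Data.Product using (_×_; _,_)
open import Relation.Binary.PropositionalEquality
  using (_≡_; sym; trans; cong; cong₂; subst; subst₂; isEquivalence; module ≡-Reasoning)
open import Algebra.Core using (Op₁; Op₂)
open import Algebra.Bundles using (CommutativeSemigroup)
import Algebra.Properties.CommutativeSemigroup as CommutativeSemigroupProperties
open import Algebra.Lattice.Bundles using (Semilattice; BooleanAlgebra)
open import Algebra.Lattice.Structures using (IsBooleanAlgebra)
open import Algebra.Lattice.Structures.Biased using (isDistributiveLatticeʳʲᵐ; isBooleanAlgebraʳ)
import Algebra.Lattice.Properties.Semilattice as SemilatticeProperties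
import Algebra.Lattice.Properties.BooleanAlgebra as BooleanAlgebraProperties
open import Relation.Binary.Lattice.Bundles using (MeetSemilattice; Lattice)
import Relation.Binary.Lattice.Properties.MeetSemilattice as MeetSemilatticeProperties
import Relation.Binary.Lattice.Properties.JoinSemilattice as JoinSemilatticeProperties
import Relation.Binary.Reasoning.PartialOrder as PartialOrderReasoning
open import Defs

record HuntingtonAlgebra (a : Level) : Set (lsuc a) where
  infixl 5 _+_
  infixl 6 _·_
  infix 8 -_
  field
    Carrier : Set a
    _+_ _·_ : Op₂ Carrier
    -_ : Op₁ Carrier
    +-comm : ∀ x y → x + y ≡ y + x
    +-assoc : ∀ x y z → (x + y) + z ≡ x + (y + z)
    huntington : ∀ x y → - (- x + - y) + - (- x + y) ≡ x
    ·-def : ∀ x y → x · y ≡ - (- x + - y)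

  +-commutativeSemigroup : CommutativeSemigroup a a
  +-commutativeSemigroup = record
    { isCommutativeSemigroup = record
      { isSemigroup = record
        { isMagma = record { isEquivalence = isEquivalence ; ∙-cong = cong₂ _+_ }
        ; assoc = +-assoc }
      ; comm = +-comm } }

  private module + = CommutativeSemigroupProperties +-commutativeSemigroup
  open ≡-Reasoning

  huntington-sym : ∀ x y → - (- x + y) + y ≡ - (- y + x) + x
  huntington-sym x y = begin
    - (- x + y) + y                                 ≡⟨ cong (- (- x + y) +_) (huntington y x) ⟨
    - (- x + y) + (- (- y + - x) + - (- y + x))     ≡⟨ +-assoc _ _ _ ⟨
    - (- x + y) + - (- y + - x) + - (- y + x)       ≡⟨ cong (λ t → t + - (- y + x)) (+-comm _ _) ⟩
    - (- y + - x) + - (- x + y) + - (- y + x)       ≡⟨ cong (λ t → - t + - (- x + y) + - (- y + x)) (+-comm (- y) (- x)) ⟩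
    - (- x + - y) + - (- x + y) + - (- y + x)       ≡⟨ cong (_+ - (- y + x)) (huntington x y) ⟩
    x + - (- y + x)                                 ≡⟨ +-comm _ _ ⟩
    - (- y + x) + x                                 ∎

  -‿involutive : ∀ x → - - x ≡ x
  -‿involutive x = begin
    - - x                                   ≡⟨ -[--x+x]+-[-x+x]≡-x (- x) ⟨
    - (- - - x + - x) + - (- - x + - x)     ≡⟨ cong₂ (λ s t → - s + - t) (+-comm _ _) (+-comm _ _) ⟩
    - (- x + - - - x) + - (- x + - - x)     ≡⟨ huntington x (- - x) ⟩
    x                                       ∎
    where
    -[--x+y]+[-[-y+x]+y]≡-x+y : ∀ x y → - (- - x + y) + (- (- y + x) + y) ≡ - x + y
    -[--x+y]+[-[-y+x]+y]≡-x+y x y = begin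
      - (- - x + y) + (- (- y + x) + y)     ≡⟨ +.x∙yz≈y∙xz _ _ _ ⟩
      - (- y + x) + (- (- - x + y) + y)     ≡⟨ cong (- (- y + x) +_) (huntington-sym (- x) y) ⟩
      - (- y + x) + (- (- y + - x) + - x)   ≡⟨ +.x∙yz≈yx∙z _ _ _ ⟩
      - (- y + - x) + - (- y + x) + - x     ≡⟨ cong (_+ - x) (huntington y x) ⟩
      y + - x                               ≡⟨ +-comm _ _ ⟩
      - x + y                               ∎
    x+-x≡--x+-x : ∀ x → x + - x ≡ - - x + - x
    x+-x≡--x+-x x = begin
      x + - x                                          ≡⟨ cong (_+ - x) (huntington x (- - x)) ⟨
      - (- x + - - - x) + - (- x + - - x) + - x        ≡⟨ +-assoc _ _ _ ⟩
      - (- x + - - - x) + (- (- x + - - x) + - x)      ≡⟨ cong₂ (λ s t → - s + (- t + - x)) (+-comm _ _) (+-comm _ _) ⟩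
      - (- - - x + - x) + (- (- - x + - x) + - x)      ≡⟨ -[--x+y]+[-[-y+x]+y]≡-x+y (- x) (- x) ⟩
      - - x + - x                                      ∎
    -[--x+x]+-[-x+x]≡-x : ∀ x → - (- - x + x) + - (- x + x) ≡ - x
    -[--x+x]+-[-x+x]≡-x x = begin
      - (- - x + x) + - (- x + x)          ≡⟨ +-comm _ _ ⟩
      - (- x + x) + - (- - x + x)          ≡⟨ cong (λ t → - t + - (- - x + x)) (trans (+-comm _ _) (x+-x≡--x+-x x)) ⟩
      - (- - x + - x) + - (- - x + x)      ≡⟨ huntington (- x) x ⟩
      - x                                  ∎

  -[-x+y]+-[x+y]≡-y : ∀ x y → - (- x + y) + - (x + y) ≡ - y
  -[-x+y]+-[x+y]≡-y x y = begin
    - (- x + y) + - (x + y)                  ≡⟨ +-comm _ _ ⟩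
    - (x + y) + - (- x + y)                  ≡⟨ cong₂ (λ s t → - s + - t) (+-comm x y) (+-comm (- x) y) ⟩
    - (y + x) + - (y + - x)                  ≡⟨ cong₂ (λ s t → - (s + t) + - (s + - x)) (-‿involutive y) (-‿involutive x) ⟨
    - (- - y + - - x) + - (- - y + - x)      ≡⟨ huntington (- y) (- x) ⟩
    - y                                      ∎

  x+-x≡y+-y : ∀ x y → x + - x ≡ y + - y
  x+-x≡y+-y x y = begin
    x + - x                                  ≡⟨ +-comm _ _ ⟩
    - x + x                                  ≡⟨ cong (_+ x) (-[-x+y]+-[x+y]≡-y y x) ⟨
    - (- y + x) + - (y + x) + x              ≡⟨ +.xy∙z≈y∙xz _ _ _ ⟩
    - (y + x) + (- (- y + x) + x)            ≡⟨ cong (- (y + x) +_) (huntington-sym y x) ⟩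
    - (y + x) + (- (- x + y) + y)            ≡⟨ +.x∙yz≈yx∙z _ _ _ ⟩
    - (- x + y) + - (y + x) + y              ≡⟨ cong (λ t → - (- x + y) + - t + y) (+-comm y x) ⟩
    - (- x + y) + - (x + y) + y              ≡⟨ cong (_+ y) (-[-x+y]+-[x+y]≡-y x y) ⟩
    - y + y                                  ≡⟨ +-comm _ _ ⟩
    y + - y                                  ∎

  -‿distrib-+ : ∀ x y → - (x + y) ≡ - x · - y
  -‿distrib-+ x y = begin
    - (x + y)             ≡⟨ cong₂ (λ s t → - (s + t)) (-‿involutive x) (-‿involutive y) ⟨
    - (- - x + - - y)     ≡⟨ ·-def (- x) (- y) ⟨
    - x · - y             ∎

  -‿distrib-· : ∀ x y → - (x · y) ≡ - x + - y
  -‿distrib-· x y = trans (cong -_ (·-def x y)) (-‿involutive _)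

  ·-comm : ∀ x y → x · y ≡ y · x
  ·-comm x y = begin
    x · y                 ≡⟨ ·-def x y ⟩
    - (- x + - y)         ≡⟨ cong -_ (+-comm _ _) ⟩
    - (- y + - x)         ≡⟨ ·-def y x ⟨
    y · x                 ∎

  ·-assoc : ∀ x y z → (x · y) · z ≡ x · (y · z)
  ·-assoc x y z = begin
    (x · y) · z           ≡⟨ ·-def _ z ⟩
    - (- (x · y) + - z)   ≡⟨ cong (λ t → - (t + - z)) (-‿distrib-· x y) ⟩
    - (- x + - y + - z)   ≡⟨ cong -_ (+-assoc _ _ _) ⟩
    - (- x + (- y + - z)) ≡⟨ cong (λ t → - (- x + t)) (-‿distrib-· y z) ⟨
    - (- x + - (y · z))   ≡⟨ ·-def x _ ⟨
    x · (y · z)           ∎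

  ·-commutativeSemigroup : CommutativeSemigroup a a
  ·-commutativeSemigroup = record
    { isCommutativeSemigroup = record
      { isSemigroup = record
        { isMagma = record { isEquivalence = isEquivalence ; ∙-cong = cong₂ _·_ }
        ; assoc = ·-assoc }
      ; comm = ·-comm } }

  private module · = CommutativeSemigroupProperties ·-commutativeSemigroup

  ·-split : ∀ x y → x · y + x · - y ≡ x
  ·-split x y = begin
    x · y + x · - y                 ≡⟨ cong₂ _+_ (·-def x y) (·-def x (- y)) ⟩
    - (- x + - y) + - (- x + - - y) ≡⟨ cong (λ t → - (- x + - y) + - (- x + t)) (-‿involutive y) ⟩
    - (- x + - y) + - (- x + y)     ≡⟨ huntington x y ⟩
    x                               ∎

  -- By x+-x≡y+-y the choice of e does not matter.
  module Bounded (e : Carrier) where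

    ⊤ ⊥ : Carrier
    ⊤ = e + - e
    ⊥ = - ⊤

    +-complementʳ : ∀ x → x + - x ≡ ⊤
    +-complementʳ x = x+-x≡y+-y x e

    -x≡-[x+x]+⊥ : ∀ x → - x ≡ - (x + x) + ⊥
    -x≡-[x+x]+⊥ x = begin
      - x                                   ≡⟨ huntington (- x) (- x) ⟨
      - (- - x + - - x) + - (- - x + - x)   ≡⟨ cong (λ s → - (s + s) + - (s + - x)) (-‿involutive x) ⟩
      - (x + x) + - (x + - x)               ≡⟨ cong (λ t → - (x + x) + - t) (+-complementʳ x) ⟩
      - (x + x) + ⊥                         ∎

    ⊤+x≡⊤ : ∀ x → ⊤ + x ≡ ⊤
    ⊤+x≡⊤ x = begin
      ⊤ + x                          ≡⟨ cong (_+ x) (trans (+-comm (- x) x) (+-complementʳ x)) ⟨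
      - x + x + x                    ≡⟨ +-assoc _ _ _ ⟩
      - x + (x + x)                  ≡⟨ cong (_+ (x + x)) (-x≡-[x+x]+⊥ x) ⟩
      - (x + x) + ⊥ + (x + x)        ≡⟨ +.xy∙z≈zx∙y _ _ _ ⟩
      (x + x) + - (x + x) + ⊥        ≡⟨ cong (_+ ⊥) (+-complementʳ (x + x)) ⟩
      ⊤ + ⊥                          ≡⟨ +-complementʳ ⊤ ⟩
      ⊤                              ∎

    +-identityʳ : ∀ x → x + ⊥ ≡ x
    +-identityʳ x = begin
      x + ⊥         ≡⟨ cong (_+ ⊥) (-‿involutive x) ⟨
      - - x + ⊥     ≡⟨ -x+⊥≡-x (- x) ⟩
      - - x         ≡⟨ -‿involutive x ⟩
      x             ∎
      where
      ⊥+⊥≡⊥ : ⊥ + ⊥ ≡ ⊥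
      ⊥+⊥≡⊥ = begin
        ⊥ + ⊥               ≡⟨ cong (λ t → - t + ⊥) (⊤+x≡⊤ ⊤) ⟨
        - (⊤ + ⊤) + ⊥       ≡⟨ -x≡-[x+x]+⊥ ⊤ ⟨
        ⊥                   ∎
      -x+⊥≡-x : ∀ x → - x + ⊥ ≡ - x
      -x+⊥≡-x x = begin
        - x + ⊥                  ≡⟨ cong (_+ ⊥) (-x≡-[x+x]+⊥ x) ⟩
        - (x + x) + ⊥ + ⊥        ≡⟨ +-assoc _ _ _ ⟩
        - (x + x) + (⊥ + ⊥)      ≡⟨ cong (- (x + x) +_) ⊥+⊥≡⊥ ⟩
        - (x + x) + ⊥            ≡⟨ -x≡-[x+x]+⊥ x ⟨
        - x                      ∎

    +-idem : ∀ x → x + x ≡ x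
    +-idem x = begin
      x + x            ≡⟨ -‿involutive _ ⟨
      - - (x + x)      ≡⟨ cong -_ (trans (-x≡-[x+x]+⊥ x) (+-identityʳ _)) ⟨
      - - x            ≡⟨ -‿involutive x ⟩
      x                ∎

    +-absorbs-· : ∀ x y → x + x · y ≡ x
    +-absorbs-· x y = begin
      x + x · y                       ≡⟨ cong (_+ x · y) (·-split x y) ⟨
      x · y + x · - y + x · y         ≡⟨ +.xy∙z≈xz∙y _ _ _ ⟩
      x · y + x · y + x · - y         ≡⟨ cong (_+ x · - y) (+-idem _) ⟩
      x · y + x · - y                 ≡⟨ ·-split x y ⟩
      x                               ∎

    ·-absorbs-+ : ∀ x y → x · (x + y) ≡ x
    ·-absorbs-+ x y = begin
      x · (x + y)               ≡⟨ ·-def x _ ⟩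
      - (- x + - (x + y))       ≡⟨ cong (λ t → - (- x + t)) (-‿distrib-+ x y) ⟩
      - (- x + - x · - y)       ≡⟨ cong -_ (+-absorbs-· (- x) (- y)) ⟩
      - - x                     ≡⟨ -‿involutive x ⟩
      x                         ∎

    x·-y+y≡x+y : ∀ x y → x · - y + y ≡ x + y
    x·-y+y≡x+y x y = begin
      x · - y + y                  ≡⟨ cong (x · - y +_) (trans (cong (y +_) (·-comm x y)) (+-absorbs-· y x)) ⟨
      x · - y + (y + x · y)        ≡⟨ +.x∙yz≈zx∙y _ _ _ ⟩
      x · y + x · - y + y          ≡⟨ cong (_+ y) (·-split x y) ⟩
      x + y                        ∎

    [x+y]·-x≡y·-x : ∀ x y → (x + y) · - x ≡ y · - x
    [x+y]·-x≡y·-x x y = begin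
      (x + y) · - x                ≡⟨ ·-def _ _ ⟩
      - (- (x + y) + - - x)        ≡⟨ cong₂ (λ s t → - (s + t)) (-‿distrib-+ x y) (-‿involutive x) ⟩
      - (- x · - y + x)            ≡⟨ cong (λ t → - (t + x)) (·-comm _ _) ⟩
      - (- y · - x + x)            ≡⟨ cong -_ (x·-y+y≡x+y (- y) x) ⟩
      - (- y + x)                  ≡⟨ cong (λ t → - (- y + t)) (-‿involutive x) ⟨
      - (- y + - - x)              ≡⟨ ·-def y (- x) ⟨
      y · - x                      ∎

    ·-distribʳ-+ : ∀ x y z → (y + z) · x ≡ y · x + z · x
    ·-distribʳ-+ x y z = begin
      (y + z) · x                                   ≡⟨ ·-split _ y ⟨
      (y + z) · x · y + (y + z) · x · - y           ≡⟨ cong₂ _+_ y-part -y-part ⟩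
      y · x + z · x · - y                           ≡⟨ cong (_+ z · x · - y) (+-absorbs-· (y · x) z) ⟨
      y · x + y · x · z + z · x · - y               ≡⟨ +-assoc _ _ _ ⟩
      y · x + (y · x · z + z · x · - y)             ≡⟨ cong (λ t → y · x + (t + z · x · - y)) (·.xy∙z≈zy∙x _ _ _) ⟩
      y · x + (z · x · y + z · x · - y)             ≡⟨ cong (y · x +_) (·-split (z · x) y) ⟩
      y · x + z · x                                 ∎
      where
      y-part : (y + z) · x · y ≡ y · x
      y-part = trans (·.xy∙z≈zx∙y _ _ _) (cong (_· x) (·-absorbs-+ y z))
      -y-part : (y + z) · x · - y ≡ z · x · - y
      -y-part = begin
        (y + z) · x · - y     ≡⟨ ·.xy∙z≈xz∙y _ _ _ ⟩
        (y + z) · - y · x     ≡⟨ cong (_· x) ([x+y]·-x≡y·-x y z) ⟩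
        z · - y · x           ≡⟨ ·.xy∙z≈xz∙y _ _ _ ⟩
        z · x · - y           ∎

    +-distribʳ-· : ∀ x y z → y · z + x ≡ (y + x) · (z + x)
    +-distribʳ-· x y z = begin
      y · z + x                         ≡⟨ -‿involutive _ ⟨
      - - (y · z + x)                   ≡⟨ cong -_ (-‿distrib-+ _ x) ⟩
      - (- (y · z) · - x)               ≡⟨ cong (λ t → - (t · - x)) (-‿distrib-· y z) ⟩
      - ((- y + - z) · - x)             ≡⟨ cong -_ (·-distribʳ-+ (- x) (- y) (- z)) ⟩
      - (- y · - x + - z · - x)         ≡⟨ cong₂ (λ s t → - (s + t)) (-‿distrib-+ y x) (-‿distrib-+ z x) ⟨
      - (- (y + x) + - (z + x))         ≡⟨ ·-def _ _ ⟨
      (y + x) · (z + x)                 ∎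

    ·-complementʳ : ∀ x → x · - x ≡ ⊥
    ·-complementʳ x = trans (·-def x (- x)) (cong -_ (+-complementʳ (- x)))

    isBooleanAlgebra : IsBooleanAlgebra _≡_ _+_ _·_ -_ ⊤ ⊥
    isBooleanAlgebra = isBooleanAlgebraʳ (record
      { isDistributiveLattice = isDistributiveLatticeʳʲᵐ (record
        { isLattice = record
          { isEquivalence = isEquivalence
          ; ∨-comm = +-comm
          ; ∨-assoc = +-assoc
          ; ∨-cong = cong₂ _+_
          ; ∧-comm = ·-comm
          ; ∧-assoc = ·-assoc
          ; ∧-cong = cong₂ _·_
          ; absorptive = +-absorbs-· , ·-absorbs-+ }
        ; ∨-distribʳ-∧ = +-distribʳ-· })
      ; ∨-complementʳ = +-complementʳ
      ; ∧-complementʳ = ·-complementʳ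
      ; ¬-cong = cong -_ })

module JAlgebraProperties {ℓ} (𝔄 : JAlgebra ℓ) where
  open JAlgebra 𝔄 hiding (_≤_)

  ·-semilattice : Semilattice ℓ ℓ
  ·-semilattice = record
    { isSemilattice = record
      { isBand = record
        { isSemigroup = record
          { isMagma = record { isEquivalence = isEquivalence ; ∙-cong = cong₂ _·_ }
          ; assoc = λ x y z → sym (·-assoc x y z) }
        ; idem = ·-idem }
      ; comm = ·-comm } }

  ·-meetSemilattice : MeetSemilattice ℓ ℓ ℓ
  ·-meetSemilattice = SemilatticeProperties.∧-orderTheoreticMeetSemilattice ·-semilattice

  -- The natural order of the library is x ≡ x · y, the symmetric form of JAlgebra._≤_.
  open MeetSemilattice ·-meetSemilattice public
    using (_≤_; poset; antisym; x∧y≤x; x∧y≤y; ∧-greatest)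
    renaming (refl to ≤-refl; trans to ≤-trans; reflexive to ≤-reflexive)
  open MeetSemilatticeProperties ·-meetSemilattice public using (∧-monotonic)
  open PartialOrderReasoning poset

  x≤𝟙 : ∀ x → x ≤ 𝟙
  x≤𝟙 x = sym (·-𝟙 x)

  ⨾-monoˡ-≤ : ∀ {x y} z → x ≤ y → x ⨾ z ≤ y ⨾ z
  ⨾-monoˡ-≤ {x} {y} z x≤y = begin-equality
    x ⨾ z                       ≡⟨ cong (_⨾ z) x≤y ⟩
    (x · y) ⨾ z                 ≡⟨ ·⨾-mono x y z ⟩
    (x · y) ⨾ z · y ⨾ z         ≡⟨ cong (λ t → t ⨾ z · y ⨾ z) x≤y ⟨
    x ⨾ z · y ⨾ z               ∎

  ˘-mono-≤ : ∀ {x y} → x ≤ y → x ˘ ≤ y ˘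
  ˘-mono-≤ {x} {y} x≤y = trans (cong _˘ x≤y) (·-˘ x y)

  ⨾-monoʳ-≤ : ∀ {x y} z → x ≤ y → z ⨾ x ≤ z ⨾ y
  ⨾-monoʳ-≤ {x} {y} z x≤y = begin
    z ⨾ x               ≡⟨ ˘˘ _ ⟨
    (z ⨾ x) ˘ ˘         ≡⟨ cong _˘ (⨾-˘ z x) ⟩
    (x ˘ ⨾ z ˘) ˘       ≤⟨ ˘-mono-≤ (⨾-monoˡ-≤ (z ˘) (˘-mono-≤ x≤y)) ⟩
    (y ˘ ⨾ z ˘) ˘       ≡⟨ cong _˘ (⨾-˘ z y) ⟨
    (z ⨾ y) ˘ ˘         ≡⟨ ˘˘ _ ⟩
    z ⨾ y               ∎

  ⨾-mono-≤ : ∀ {x x′ y y′} → x ≤ x′ → y ≤ y′ → x ⨾ y ≤ x′ ⨾ y′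
  ⨾-mono-≤ {x′ = x′} {y} x≤x′ y≤y′ = ≤-trans (⨾-monoˡ-≤ y x≤x′) (⨾-monoʳ-≤ x′ y≤y′)

  𝟙˘≡𝟙 : 𝟙 ˘ ≡ 𝟙
  𝟙˘≡𝟙 = antisym (x≤𝟙 (𝟙 ˘)) (subst (_≤ 𝟙 ˘) (˘˘ 𝟙) (˘-mono-≤ (x≤𝟙 (𝟙 ˘))))

  dedekindˡ : ∀ x y z → x ⨾ y · z ≤ (x · z ⨾ y ˘) ⨾ y
  dedekindˡ x y z = begin
    x ⨾ y · z                                 ≡⟨ modular x y z ⟩
    (z ⨾ y ˘ · x) ⨾ (y · x ˘ ⨾ z) · z         ≤⟨ x∧y≤x _ z ⟩
    (z ⨾ y ˘ · x) ⨾ (y · x ˘ ⨾ z)             ≤⟨ ⨾-mono-≤ (≤-reflexive (·-comm _ _)) (x∧y≤x y _) ⟩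
    (x · z ⨾ y ˘) ⨾ y                         ∎

  dedekindʳ : ∀ x y z → x ⨾ y · z ≤ x ⨾ (y · x ˘ ⨾ z)
  dedekindʳ x y z = begin
    x ⨾ y · z                                 ≡⟨ modular x y z ⟩
    (z ⨾ y ˘ · x) ⨾ (y · x ˘ ⨾ z) · z         ≤⟨ x∧y≤x _ z ⟩
    (z ⨾ y ˘ · x) ⨾ (y · x ˘ ⨾ z)             ≤⟨ ⨾-monoˡ-≤ _ (x∧y≤y _ x) ⟩
    x ⨾ (y · x ˘ ⨾ z)                         ∎

  Functional : Carrier → Set ℓ
  Functional c = c ˘ ⨾ c ≤ 1'

  functional-cancelʳ : ∀ {c} → Functional c → ∀ x → x ⨾ c ˘ ⨾ c ≤ x
  functional-cancelʳ {c} c-functional x = begin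
    x ⨾ c ˘ ⨾ c         ≡⟨ ⨾-assoc x (c ˘) c ⟨
    x ⨾ (c ˘ ⨾ c)       ≤⟨ ⨾-monoʳ-≤ x c-functional ⟩
    x ⨾ 1'              ≡⟨ ⨾-1' x ⟩
    x                   ∎

  functional-cancel : ∀ {c} → Functional c → ∀ x y → (x ⨾ c ˘) ⨾ (c ⨾ y) ≤ x ⨾ y
  functional-cancel {c} c-functional x y = begin
    (x ⨾ c ˘) ⨾ (c ⨾ y)   ≡⟨ ⨾-assoc _ c y ⟩
    x ⨾ c ˘ ⨾ c ⨾ y       ≤⟨ ⨾-monoˡ-≤ y (functional-cancelʳ c-functional x) ⟩
    x ⨾ y                 ∎

  ≤-𝟙-factor : ∀ {p q} → 𝟙 ≡ p ˘ ⨾ q → ∀ x → x ≤ p ˘ ⨾ (p ⨾ x · q)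
  ≤-𝟙-factor {p} {q} 𝟙≡p˘⨾q x = begin
    x                         ≡⟨ ·-𝟙 x ⟨
    x · 𝟙                     ≡⟨ trans (cong (x ·_) 𝟙≡p˘⨾q) (·-comm x _) ⟩
    p ˘ ⨾ q · x               ≤⟨ dedekindʳ (p ˘) q x ⟩
    p ˘ ⨾ (q · p ˘ ˘ ⨾ x)     ≡⟨ cong (λ t → p ˘ ⨾ (q · t ⨾ x)) (˘˘ p) ⟩
    p ˘ ⨾ (q · p ⨾ x)         ≡⟨ cong (p ˘ ⨾_) (·-comm q _) ⟩
    p ˘ ⨾ (p ⨾ x · q)         ∎

  module Decomposition {a b} (a-functional : Functional a) (b-functional : Functional b)
                       (𝟙≡a˘⨾b : 𝟙 ≡ a ˘ ⨾ b) where

    𝟙≡b˘⨾a : 𝟙 ≡ b ˘ ⨾ a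
    𝟙≡b˘⨾a = begin-equality
      𝟙                 ≡⟨ 𝟙˘≡𝟙 ⟨
      𝟙 ˘               ≡⟨ cong _˘ 𝟙≡a˘⨾b ⟩
      (a ˘ ⨾ b) ˘       ≡⟨ ⨾-˘ (a ˘) b ⟩
      b ˘ ⨾ a ˘ ˘       ≡⟨ cong (b ˘ ⨾_) (˘˘ a) ⟩
      b ˘ ⨾ a           ∎

    ⨾-·-factor : ∀ u v z → u ⨾ v · z ≤ (u ⨾ a ˘ · z ⨾ b ˘) ⨾ (a ⨾ v · b)
    ⨾-·-factor u v z = begin
      u ⨾ v · z                           ≤⟨ ∧-monotonic (⨾-monoʳ-≤ u (≤-𝟙-factor 𝟙≡a˘⨾b v)) ≤-refl ⟩
      u ⨾ (a ˘ ⨾ w) · z                   ≡⟨ cong (_· z) (⨾-assoc u (a ˘) w) ⟩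
      u ⨾ a ˘ ⨾ w · z                     ≤⟨ dedekindˡ (u ⨾ a ˘) w z ⟩
      (u ⨾ a ˘ · z ⨾ w ˘) ⨾ w             ≤⟨ ⨾-monoˡ-≤ w (∧-monotonic ≤-refl (⨾-monoʳ-≤ z (˘-mono-≤ (x∧y≤y _ b)))) ⟩
      (u ⨾ a ˘ · z ⨾ b ˘) ⨾ w             ∎
      where w = a ⨾ v · b

    -- t leads from the code of (r, s) to a code of (r, s′) with s y s′: it keeps the
    -- a-coordinate and moves the b-coordinate along y.
    re-pair : ∀ u x y → u ⨾ a ˘ · x ⨾ y ⨾ b ˘ ≤ (x ⨾ b ˘ · u ⨾ a ˘) ⨾ (a ⨾ a ˘ · b ⨾ y ⨾ b ˘)
    re-pair u x y = ≤-trans (∧-greatest (x∧y≤x _ _) through-b˘) pair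
      where
      t = a ⨾ a ˘ · b ⨾ y ⨾ b ˘
      x˘⨾u⨾a˘≤b˘⨾[a⨾a˘] : x ˘ ⨾ (u ⨾ a ˘) ≤ b ˘ ⨾ (a ⨾ a ˘)
      x˘⨾u⨾a˘≤b˘⨾[a⨾a˘] = begin
        x ˘ ⨾ (u ⨾ a ˘)         ≡⟨ ⨾-assoc (x ˘) u (a ˘) ⟩
        x ˘ ⨾ u ⨾ a ˘           ≤⟨ ⨾-monoˡ-≤ (a ˘) (x≤𝟙 _) ⟩
        𝟙 ⨾ a ˘                 ≡⟨ trans (cong (_⨾ a ˘) 𝟙≡b˘⨾a) (sym (⨾-assoc (b ˘) a (a ˘))) ⟩
        b ˘ ⨾ (a ⨾ a ˘)         ∎
      through-b˘ : u ⨾ a ˘ · x ⨾ y ⨾ b ˘ ≤ x ⨾ b ˘ ⨾ t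
      through-b˘ = begin
        u ⨾ a ˘ · x ⨾ y ⨾ b ˘                       ≡⟨ trans (·-comm _ _) (cong (_· u ⨾ a ˘) (sym (⨾-assoc x y (b ˘)))) ⟩
        x ⨾ (y ⨾ b ˘) · u ⨾ a ˘                     ≤⟨ dedekindʳ x (y ⨾ b ˘) (u ⨾ a ˘) ⟩
        x ⨾ (y ⨾ b ˘ · x ˘ ⨾ (u ⨾ a ˘))             ≤⟨ ⨾-monoʳ-≤ x (∧-monotonic ≤-refl x˘⨾u⨾a˘≤b˘⨾[a⨾a˘]) ⟩
        x ⨾ (y ⨾ b ˘ · b ˘ ⨾ (a ⨾ a ˘))             ≡⟨ cong (x ⨾_) (·-comm _ _) ⟩
        x ⨾ (b ˘ ⨾ (a ⨾ a ˘) · y ⨾ b ˘)             ≤⟨ ⨾-monoʳ-≤ x (dedekindʳ (b ˘) (a ⨾ a ˘) (y ⨾ b ˘)) ⟩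
        x ⨾ (b ˘ ⨾ (a ⨾ a ˘ · b ˘ ˘ ⨾ (y ⨾ b ˘)))   ≡⟨ cong (λ s → x ⨾ (b ˘ ⨾ (a ⨾ a ˘ · s))) (trans (cong (_⨾ (y ⨾ b ˘)) (˘˘ b)) (⨾-assoc b y (b ˘))) ⟩
        x ⨾ (b ˘ ⨾ t)                               ≡⟨ ⨾-assoc x (b ˘) t ⟩
        x ⨾ b ˘ ⨾ t                                 ∎
      u⨾a˘⨾t˘≤u⨾a˘ : u ⨾ a ˘ ⨾ t ˘ ≤ u ⨾ a ˘
      u⨾a˘⨾t˘≤u⨾a˘ = begin
        u ⨾ a ˘ ⨾ t ˘               ≤⟨ ⨾-monoʳ-≤ (u ⨾ a ˘) (˘-mono-≤ (x∧y≤x _ _)) ⟩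
        u ⨾ a ˘ ⨾ (a ⨾ a ˘) ˘       ≡⟨ cong (u ⨾ a ˘ ⨾_) (trans (⨾-˘ a (a ˘)) (cong (_⨾ a ˘) (˘˘ a))) ⟩
        u ⨾ a ˘ ⨾ (a ⨾ a ˘)         ≤⟨ functional-cancel a-functional u (a ˘) ⟩
        u ⨾ a ˘                     ∎
      pair : u ⨾ a ˘ · x ⨾ b ˘ ⨾ t ≤ (x ⨾ b ˘ · u ⨾ a ˘) ⨾ t
      pair = begin
        u ⨾ a ˘ · x ⨾ b ˘ ⨾ t                 ≡⟨ ·-comm _ _ ⟩
        x ⨾ b ˘ ⨾ t · u ⨾ a ˘                 ≤⟨ dedekindˡ (x ⨾ b ˘) t (u ⨾ a ˘) ⟩
        (x ⨾ b ˘ · u ⨾ a ˘ ⨾ t ˘) ⨾ t         ≤⟨ ⨾-monoˡ-≤ t (∧-monotonic ≤-refl u⨾a˘⨾t˘≤u⨾a˘) ⟩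
        (x ⨾ b ˘ · u ⨾ a ˘) ⨾ t               ∎

    transfer : ∀ v y → (a ⨾ a ˘ · b ⨾ y ⨾ b ˘) ⨾ (a ⨾ v · b) ≤ a ⨾ v · b ⨾ y
    transfer v y = ∧-greatest
      (≤-trans (⨾-mono-≤ (x∧y≤x _ _) (x∧y≤x _ _)) (functional-cancel a-functional a v))
      (≤-trans (⨾-mono-≤ (x∧y≤y _ _) (x∧y≤y _ _)) (functional-cancelʳ b-functional (b ⨾ y)))

    decomposition-≤ : ∀ u v x y → u ⨾ v · x ⨾ y ≤ (u ⨾ a ˘ · x ⨾ b ˘) ⨾ (a ⨾ v · b ⨾ y)
    decomposition-≤ u v x y = begin
      u ⨾ v · x ⨾ y                                     ≤⟨ ⨾-·-factor u v (x ⨾ y) ⟩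
      (u ⨾ a ˘ · x ⨾ y ⨾ b ˘) ⨾ (a ⨾ v · b)             ≤⟨ ⨾-monoˡ-≤ _ (re-pair u x y) ⟩
      (x ⨾ b ˘ · u ⨾ a ˘) ⨾ t ⨾ (a ⨾ v · b)             ≡⟨ ⨾-assoc _ t _ ⟨
      (x ⨾ b ˘ · u ⨾ a ˘) ⨾ (t ⨾ (a ⨾ v · b))           ≤⟨ ⨾-mono-≤ (≤-reflexive (·-comm _ _)) (transfer v y) ⟩
      (u ⨾ a ˘ · x ⨾ b ˘) ⨾ (a ⨾ v · b ⨾ y)             ∎
      where t = a ⨾ a ˘ · b ⨾ y ⨾ b ˘

    decomposition-≥ : ∀ u v x y → (u ⨾ a ˘ · x ⨾ b ˘) ⨾ (a ⨾ v · b ⨾ y) ≤ u ⨾ v · x ⨾ y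
    decomposition-≥ u v x y = ∧-greatest
      (≤-trans (⨾-mono-≤ (x∧y≤x _ _) (x∧y≤x _ _)) (functional-cancel a-functional u v))
      (≤-trans (⨾-mono-≤ (x∧y≤y _ _) (x∧y≤y _ _)) (functional-cancel b-functional x y))

    decomposition : ∀ u v x y → u ⨾ v · x ⨾ y ≡ (u ⨾ a ˘ · x ⨾ b ˘) ⨾ (a ⨾ v · b ⨾ y)
    decomposition u v x y = antisym (decomposition-≤ u v x y) (decomposition-≥ u v x y)

module RelationAlgebraProperties {ℓ} (𝔄 : RelationAlgebra ℓ) where
  open RelationAlgebra 𝔄 hiding (_≤_)

  huntingtonAlgebra : HuntingtonAlgebra ℓ
  huntingtonAlgebra = record
    { Carrier = Carrier ; _+_ = _+_ ; _·_ = _·_ ; -_ = -_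
    ; +-comm = +-comm ; +-assoc = λ x y z → sym (+-assoc x y z)
    ; huntington = huntington ; ·-def = ·-def }

  booleanAlgebra : BooleanAlgebra ℓ ℓ
  booleanAlgebra = record
    { Carrier = Carrier ; _≈_ = _≡_ ; _∨_ = _+_ ; _∧_ = _·_ ; ¬_ = -_ ; ⊤ = 𝟙 ; ⊥ = 𝟘
    ; isBooleanAlgebra = subst₂ (IsBooleanAlgebra _≡_ _+_ _·_ -_)
        (sym 𝟙-def) (sym (trans 𝟘-def (cong -_ 𝟙-def)))
        (HuntingtonAlgebra.Bounded.isBooleanAlgebra huntingtonAlgebra 1') }

  open BooleanAlgebra booleanAlgebra
    using (∧-comm; ∧-assoc; ∧-distribˡ-∨; ∧-distribʳ-∨; ∨-complementʳ; ∧-complementˡ)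
  open BooleanAlgebraProperties booleanAlgebra
    using (∧-idem; ∧-identityʳ; ∨-identityˡ; ∨-identityʳ; ∧-zeroˡ; ∧-zeroʳ; ∨-∧-orderTheoreticLattice)
  open Lattice ∨-∧-orderTheoreticLattice
    using (_≤_; poset; antisym; x≤x∨y; x∧y≤x; x∧y≤y; ∧-greatest; joinSemilattice; meetSemilattice)
    renaming (refl to ≤-refl; trans to ≤-trans; reflexive to ≤-reflexive)
  open JoinSemilatticeProperties joinSemilattice using (x≤y⇒x∨y≈y)
  open MeetSemilatticeProperties meetSemilattice using (∧-monotonic)
  open PartialOrderReasoning poset

  +≡⇒≤ : ∀ {x y} → x + y ≡ y → x ≤ y
  +≡⇒≤ {x} x+y≡y = subst (x ≤_) x+y≡y (x≤x∨y x _)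

  +-homomorphism⇒mono-≤ : (f : Op₁ Carrier) → (∀ x y → f (x + y) ≡ f x + f y) →
                          ∀ {x y} → x ≤ y → f x ≤ f y
  +-homomorphism⇒mono-≤ f f-+ {x} {y} x≤y = +≡⇒≤ (trans (sym (f-+ x y)) (cong f (x≤y⇒x∨y≈y x≤y)))

  ⨾-distribˡ-+ : ∀ z x y → z ⨾ (x + y) ≡ z ⨾ x + z ⨾ y
  ⨾-distribˡ-+ z x y = begin-equality
    z ⨾ (x + y)                     ≡⟨ ˘˘ _ ⟨
    (z ⨾ (x + y)) ˘ ˘               ≡⟨ cong _˘ (⨾-˘ z (x + y)) ⟩
    ((x + y) ˘ ⨾ z ˘) ˘             ≡⟨ cong (λ w → (w ⨾ z ˘) ˘) (+-˘ x y) ⟩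
    ((x ˘ + y ˘) ⨾ z ˘) ˘           ≡⟨ cong _˘ (⨾-distribʳ-+ (x ˘) (y ˘) (z ˘)) ⟩
    (x ˘ ⨾ z ˘ + y ˘ ⨾ z ˘) ˘       ≡⟨ +-˘ _ _ ⟩
    (x ˘ ⨾ z ˘) ˘ + (y ˘ ⨾ z ˘) ˘   ≡⟨ cong₂ _+_ (cong _˘ (⨾-˘ z x)) (cong _˘ (⨾-˘ z y)) ⟨
    (z ⨾ x) ˘ ˘ + (z ⨾ y) ˘ ˘       ≡⟨ cong₂ _+_ (˘˘ _) (˘˘ _) ⟩
    z ⨾ x + z ⨾ y                   ∎

  ⨾-monoˡ-≤ : ∀ {x y} z → x ≤ y → x ⨾ z ≤ y ⨾ z
  ⨾-monoˡ-≤ z = +-homomorphism⇒mono-≤ (_⨾ z) (λ x y → ⨾-distribʳ-+ x y z)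

  ⨾-monoʳ-≤ : ∀ {x y} z → x ≤ y → z ⨾ x ≤ z ⨾ y
  ⨾-monoʳ-≤ z = +-homomorphism⇒mono-≤ (z ⨾_) (⨾-distribˡ-+ z)

  ˘-mono-≤ : ∀ {x y} → x ≤ y → x ˘ ≤ y ˘
  ˘-mono-≤ = +-homomorphism⇒mono-≤ _˘ +-˘

  ≤˘⇒˘≤ : ∀ {x y} → x ≤ y ˘ → x ˘ ≤ y
  ≤˘⇒˘≤ {y = y} x≤y˘ = subst (_ ≤_) (˘˘ y) (˘-mono-≤ x≤y˘)

  ·-˘ : ∀ x y → (x · y) ˘ ≡ x ˘ · y ˘
  ·-˘ x y = antisym
    (∧-greatest (˘-mono-≤ (x∧y≤x x y)) (˘-mono-≤ (x∧y≤y x y)))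
    (subst (_≤ (x · y) ˘) (˘˘ _)
      (˘-mono-≤ (∧-greatest (≤˘⇒˘≤ (x∧y≤x (x ˘) (y ˘))) (≤˘⇒˘≤ (x∧y≤y (x ˘) (y ˘))))))

  ·≡𝟘⇒≤- : ∀ {x y} → x · y ≡ 𝟘 → y ≤ - x
  ·≡𝟘⇒≤- {x} {y} x·y≡𝟘 = begin-equality
    y                       ≡⟨ ∧-identityʳ y ⟨
    y · 𝟙                   ≡⟨ cong (y ·_) (∨-complementʳ x) ⟨
    y · (x + - x)           ≡⟨ ∧-distribˡ-∨ y x (- x) ⟩
    y · x + y · - x         ≡⟨ cong (_+ y · - x) (trans (∧-comm y x) x·y≡𝟘) ⟩
    𝟘 + y · - x             ≡⟨ ∨-identityˡ _ ⟩
    y · - x                 ∎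

  ≤-⇒·≡𝟘 : ∀ {x y} → x ≤ - y → x · y ≡ 𝟘
  ≤-⇒·≡𝟘 {x} {y} x≤-y = begin-equality
    x · y                   ≡⟨ cong (_· y) x≤-y ⟩
    x · - y · y             ≡⟨ ∧-assoc x (- y) y ⟩
    x · (- y · y)           ≡⟨ cong (x ·_) (∧-complementˡ y) ⟩
    x · 𝟘                   ≡⟨ ∧-zeroʳ x ⟩
    𝟘                       ∎

  𝟘˘≡𝟘 : 𝟘 ˘ ≡ 𝟘
  𝟘˘≡𝟘 = antisym (subst (𝟘 ˘ ≤_) (˘˘ 𝟘) (˘-mono-≤ (sym (∧-zeroˡ (𝟘 ˘))))) (sym (∧-zeroˡ (𝟘 ˘)))

  ⨾·-˘ : ∀ x y z → (x ⨾ y · z) ˘ ≡ y ˘ ⨾ x ˘ · z ˘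
  ⨾·-˘ x y z = trans (·-˘ (x ⨾ y) z) (cong (_· z ˘) (⨾-˘ x y))

  schröder : ∀ {x y z} → x ⨾ y · z ≡ 𝟘 → x ˘ ⨾ z · y ≡ 𝟘
  schröder {x} {y} {z} x⨾y·z≡𝟘 = ≤-⇒·≡𝟘 (begin
    x ˘ ⨾ z                 ≤⟨ ⨾-monoʳ-≤ (x ˘) (·≡𝟘⇒≤- x⨾y·z≡𝟘) ⟩
    x ˘ ⨾ - (x ⨾ y)         ≤⟨ +≡⇒≤ (tarski x y) ⟩
    - y                     ∎)

  schröder-˘ : ∀ {x y z} → x ˘ ⨾ z · y ≡ 𝟘 → x ⨾ y · z ≡ 𝟘
  schröder-˘ {x} {y} {z} = subst (λ w → w ⨾ y · z ≡ 𝟘) (˘˘ x) ∘ schröder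

  schröder-⨾˘ : ∀ {x y z} → z ⨾ y ˘ · x ≡ 𝟘 → x ⨾ y · z ≡ 𝟘
  schröder-⨾˘ {x} {y} {z} z⨾y˘·x≡𝟘 = begin-equality
    x ⨾ y · z                 ≡⟨ ˘˘ _ ⟨
    (x ⨾ y · z) ˘ ˘           ≡⟨ cong _˘ (⨾·-˘ x y z) ⟩
    (y ˘ ⨾ x ˘ · z ˘) ˘       ≡⟨ cong _˘ (schröder-˘ (trans (sym (⨾·-˘ z (y ˘) x)) (trans (cong _˘ z⨾y˘·x≡𝟘) 𝟘˘≡𝟘))) ⟩
    𝟘 ˘                       ≡⟨ 𝟘˘≡𝟘 ⟩
    𝟘                         ∎

  x·[y·-x]≡𝟘 : ∀ x y → x · (y · - x) ≡ 𝟘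
  x·[y·-x]≡𝟘 x y = trans (∧-comm x _) (≤-⇒·≡𝟘 (x∧y≤y y (- x)))

  +-homomorphism⇒restrict : (f : Op₁ Carrier) → (∀ x y → f (x + y) ≡ f x + f y) →
                            ∀ {p q z} → f (p · - q) · z ≡ 𝟘 → f p · z ≡ f (p · q) · z
  +-homomorphism⇒restrict f f-+ {p} {q} {z} f[p·-q]·z≡𝟘 = begin-equality
    f p · z                               ≡⟨ cong (λ t → f t · z) (∧-identityʳ p) ⟨
    f (p · 𝟙) · z                         ≡⟨ cong (λ t → f (p · t) · z) (∨-complementʳ q) ⟨
    f (p · (q + - q)) · z                 ≡⟨ cong (λ t → f t · z) (∧-distribˡ-∨ p q (- q)) ⟩
    f (p · q + p · - q) · z               ≡⟨ cong (_· z) (f-+ _ _) ⟩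
    (f (p · q) + f (p · - q)) · z         ≡⟨ ∧-distribʳ-∨ z _ _ ⟩
    f (p · q) · z + f (p · - q) · z       ≡⟨ cong (f (p · q) · z +_) f[p·-q]·z≡𝟘 ⟩
    f (p · q) · z + 𝟘                     ≡⟨ ∨-identityʳ _ ⟩
    f (p · q) · z                         ∎

  -- The parts of x outside z ⨾ y ˘ and of y outside x′ ˘ ⨾ z contribute 𝟘, by Schröder.
  dedekind : ∀ x y z → x ⨾ y · z ≤ (x · z ⨾ y ˘) ⨾ (y · x ˘ ⨾ z)
  dedekind x y z = begin
    x ⨾ y · z                   ≡⟨ +-homomorphism⇒restrict (_⨾ y) (λ p q → ⨾-distribʳ-+ p q y)
                                     (schröder-⨾˘ (x·[y·-x]≡𝟘 (z ⨾ y ˘) x)) ⟩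
    x′ ⨾ y · z                  ≡⟨ +-homomorphism⇒restrict (x′ ⨾_) (⨾-distribˡ-+ x′)
                                     (schröder-˘ (x·[y·-x]≡𝟘 (x′ ˘ ⨾ z) y)) ⟩
    x′ ⨾ (y · x′ ˘ ⨾ z) · z     ≤⟨ x∧y≤x _ z ⟩
    x′ ⨾ (y · x′ ˘ ⨾ z)         ≤⟨ ⨾-monoʳ-≤ x′ (∧-monotonic ≤-refl (⨾-monoˡ-≤ z (˘-mono-≤ (x∧y≤x x _)))) ⟩
    x′ ⨾ (y · x ˘ ⨾ z)          ∎
    where x′ = x · z ⨾ y ˘

  modular : ∀ x y z → x ⨾ y · z ≡ (z ⨾ y ˘ · x) ⨾ (y · x ˘ ⨾ z) · z
  modular x y z = antisym
    (∧-greatest (≤-trans (dedekind x y z) (⨾-monoˡ-≤ _ (≤-reflexive (∧-comm x _)))) (x∧y≤y _ z))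
    (∧-monotonic (≤-trans (⨾-monoʳ-≤ _ (x∧y≤x y _)) (⨾-monoˡ-≤ y (x∧y≤y _ x))) ≤-refl)

  ⨾-zeroʳ : ∀ x → x ⨾ 𝟘 ≡ 𝟘
  ⨾-zeroʳ x = trans (sym (∧-identityʳ _)) (schröder-˘ (∧-zeroʳ (x ˘ ⨾ 𝟙)))

  jAlgebra : JAlgebra ℓ
  jAlgebra = record
    { Carrier = Carrier ; _·_ = _·_ ; 𝟘 = 𝟘 ; 𝟙 = 𝟙 ; _⨾_ = _⨾_ ; _˘ = _˘ ; 1' = 1'
    ; ·-assoc = λ x y z → sym (∧-assoc x y z)
    ; ·-comm = ∧-comm
    ; ·-idem = ∧-idem
    ; ⨾-assoc = ⨾-assoc
    ; ⨾-1' = ⨾-1'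
    ; ·⨾-mono = λ x y z → ⨾-monoˡ-≤ z (x∧y≤y x y)
    ; ˘˘ = ˘˘
    ; ⨾-˘ = ⨾-˘
    ; ·-˘ = ·-˘
    ; modular = modular
    ; 𝟘-· = ∧-zeroˡ
    ; ·-𝟙 = ∧-identityʳ
    ; ⨾-𝟘 = ⨾-zeroʳ
    }

jAlgebra-decomposition : ∀ {ℓ} (𝔄 : JAlgebra ℓ) → let open JAlgebra 𝔄 in
  (a b : Carrier) → a ˘ ⨾ a ≤ 1' → b ˘ ⨾ b ≤ 1' → 𝟙 ≡ a ˘ ⨾ b →
  ∀ u v x y → u ⨾ v · x ⨾ y ≡ (u ⨾ a ˘ · x ⨾ b ˘) ⨾ (a ⨾ v · b ⨾ y)
jAlgebra-decomposition 𝔄 a b a˘⨾a≤1' b˘⨾b≤1' 𝟙≡a˘⨾b =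
  Decomposition.decomposition (sym a˘⨾a≤1') (sym b˘⨾b≤1') 𝟙≡a˘⨾b
  where open JAlgebraProperties 𝔄

proposition21 : ∀ {ℓ : Level} →
    ((𝔄 : JAlgebra ℓ) → let open JAlgebra 𝔄 in
      (a b : Carrier) → a ˘ ⨾ a ≤ 1' → b ˘ ⨾ b ≤ 1' → 𝟙 ≡ a ˘ ⨾ b →
      ∀ u v x y → u ⨾ v · x ⨾ y ≡ (u ⨾ a ˘ · x ⨾ b ˘) ⨾ (a ⨾ v · b ⨾ y))
    ×
    ((𝔄 : RelationAlgebra ℓ) → let open RelationAlgebra 𝔄 in
      (a b : Carrier) → a ˘ ⨾ a ≤ 1' → b ˘ ⨾ b ≤ 1' → 𝟙 ≡ a ˘ ⨾ b →
      ∀ u v x y → u ⨾ v · x ⨾ y ≡ (u ⨾ a ˘ · x ⨾ b ˘) ⨾ (a ⨾ v · b ⨾ y))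
proposition21 = jAlgebra-decomposition , jAlgebra-decomposition ∘ RelationAlgebraProperties.jAlgebra
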